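{- Let $r\in\{0,1\}$. If a vector $(x_\alpha,\ldots,x_1)$ is $r$-realizable, then for every $1\le k\le\alpha$ the vector $(x_\alpha,\ldots,x_k)$ is $r$-realizable.
   Context: All graphs are finite, nonempty, simple and reflexive. Corner ranking: $N[v]$ is the closed neighborhood. In a graph $H$, $w$ strictly corners a distinct vertex $v$ if $N[v]\subsetneq N[w]$. Set $G^{(1)}=G$, $k=1$. If $G^{(k)}$ is a clique, give its vertices rank $k$ and stop; else if it has no strict corners, give its vertices rank $\infty$ and stop; else give all strict corners of $G^{(k)}$ rank $k$, delete them to get $G^{(k+1)}$, increase $k$, repeat. The corner rank $\alpha$ is the largest vertex rank; cop-win graphs are those with finite corner rank. $G$ is of type 1 if some (equivalently every) vertex of rank $\alpha$ is adjacent to all vertices of $G^{(\alpha-1)}$, type 0 otherwise. The rank cardinality vector of $G$ is $(x_\alpha,\ldots,x_1)$, $x_k$ the number of vertices of rank $k$. A vector of positive integers is $r$-realizable if it is the rank cardinality vector of some cop-win graph of type $r$. -}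

module Defs where

open import Data.Nat using (ℕ; zero; suc; _≤_; _<_; _∸_; _≟_)
open import Data.Fin using (Fin)
open import Data.Bool using (Bool; true)
open import Data.List using (List; map; filter; length; downFrom; allFin)
open import Data.List.Relation.Unary.All using (All)
open import Data.Product using (Σ; ∃; _×_)
open import Relation.Nullary using (¬_)
open import Relation.Binary.PropositionalEquality using (_≡_; _≢_)
open import Function.Bundles using (_⇔_)

-- A finite simple graph on vertex set Fin n, made reflexive
-- (every vertex is considered adjacent to itself, so N[v] is the closed neighbourhood).
record Graph (n : ℕ) : Set where
  field
    adj     : Fin n → Fin n → Bool
    adj-sym : ∀ u v → adj u v ≡ adj v u
    adj-ref : ∀ v → adj v v ≡ true

open Graph public

Adj : ∀ {n} → Graph n → Fin n → Fin n → Set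
Adj G u v = adj G u v ≡ true

VSet : ℕ → Set₁
VSet n = Fin n → Set

IsClique : ∀ {n} → Graph n → VSet n → Set
IsClique G S = ∀ u v → S u → S v → Adj G u v

StrictCorner : ∀ {n} → Graph n → VSet n → Fin n → Set
StrictCorner G S v =
  S v × ∃ λ w → S w × w ≢ v
    × (∀ u → S u → Adj G u v → Adj G u w)
    × (∃ λ u → S u × Adj G u w × ¬ Adj G u v)

-- G^(k) for a given rank function ρ : vertices of rank ≥ k.
Stage : ∀ {n} → (Fin n → ℕ) → ℕ → VSet n
Stage ρ k v = k ≤ ρ v

-- This is exactly the output specification of the corner-ranking procedure
-- in the case it terminates at a clique (i.e. G is cop-win):
--  * every rank lies in 1..α and rank α is attained;
--  * for 1 ≤ k < α, G^(k) is not a clique, and the vertices of rank k are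
--    exactly the strict corners of G^(k);
--  * G^(α) is a clique (all its vertices get rank α).
record CornerRanking {n} (G : Graph n) (α : ℕ) (ρ : Fin n → ℕ) : Set where
  field
    rank-pos    : ∀ v → 1 ≤ ρ v
    rank-le     : ∀ v → ρ v ≤ α
    rank-top    : ∃ λ v → ρ v ≡ α
    stage-noncl : ∀ k → 1 ≤ k → k < α → ¬ IsClique G (Stage ρ k)
    stage-corn  : ∀ k → 1 ≤ k → k < α → ∀ v → (ρ v ≡ k) ⇔ StrictCorner G (Stage ρ k) v
    last-clique : IsClique G (Stage ρ α)

Type1 : ∀ {n} → Graph n → ℕ → (Fin n → ℕ) → Set
Type1 G α ρ = ∃ λ v → ρ v ≡ α × (∀ u → Stage ρ (α ∸ 1) u → Adj G v u)

-- G (with corner rank α ≥ 2) has type r ∈ {0,1}.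
-- Convention: a graph of corner rank 1 (a clique) counts as both type 0 and type 1.
HasType : ∀ {n} → Graph n → ℕ → (Fin n → ℕ) → ℕ → Set
HasType G α ρ r = 2 ≤ α → (r ≡ 1 → Type1 G α ρ) × (r ≡ 0 → ¬ Type1 G α ρ)

rankCount : ∀ {n} → (Fin n → ℕ) → ℕ → ℕ
rankCount {n} ρ k = length (filter (λ v → ρ v ≟ k) (allFin n))

-- Rank cardinality vector (x_α, …, x_1), as a list in that order.
rankVector : ∀ {n} → (Fin n → ℕ) → ℕ → List ℕ
rankVector ρ α = map (λ i → rankCount ρ (suc i)) (downFrom α)

Realizable : ℕ → List ℕ → Set
Realizable r xs =
  All (λ x → 1 ≤ x) xs ×
  (∃ λ m → Σ (Graph (suc m)) λ G → ∃ λ α → Σ (Fin (suc m) → ℕ) λ ρ →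
     CornerRanking G α ρ × HasType G α ρ r × rankVector ρ α ≡ xs)

module Submission where

open import Defs
open import Data.Nat using (ℕ; _≤_; _∸_; _+_)
open import Data.List using (List; length; take)

open import Data.Nat using (zero; suc; _<_; _≟_; _<?_; s≤s; z≤n)
open import Data.Nat.Properties
open import Data.Fin using (Fin)
open import Data.List using ([]; _∷_; map; filter; downFrom; allFin; lookup)
open import Data.List.Properties using (length-map; length-downFrom; tabulate-lookup; map-tabulate)
open import Data.List.Relation.Unary.All using (All)
import Data.List.Relation.Unary.All as All
open import Data.List.Relation.Unary.All.Properties using (take⁺)
import Data.List.Relation.Unary.Any as Any
open import Data.List.Relation.Unary.Any.Properties using (lookup-index)
open import Data.List.Relation.Unary.AllPairs using (_∷_)
open import Data.List.Relation.Unary.Unique.Propositional using (Unique)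
import Data.List.Relation.Unary.Unique.Propositional.Properties as Unique
open import Data.List.Membership.Propositional.Properties using (∈-filter⁺; ∈-filter⁻; ∈-allFin; ∈-lookup)
open import Data.Product using (Σ; ∃; _×_; _,_; proj₁; proj₂)
open import Relation.Nullary using (yes; no; contradiction)
open import Relation.Unary using (Decidable)
open import Relation.Binary.PropositionalEquality
open import Function using (_∘_)
open import Function.Bundles using (_⇔_; mk⇔; Equivalence)
import Function.Properties.Equivalence as ⇔

-- Let ρ be the corner ranking of G, with corner rank α, and let
-- 1 ≤ k = c + 1 ≤ α.  Whether a vertex is a strict corner of a stage, and
-- whether a stage is a clique, depend only on the subgraph induced by that
-- stage.  Hence on the induced subgraph G^(c+1) (the vertices of rank > c)
-- the corner-ranking procedure repeats steps c+1, c+2, …, α of the run on G: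
-- its ranking is ρ - c, its corner rank is α - c, its j-th stage is the
-- (j + c)-th stage of G, and its type equals that of G.  So G^(c+1) realizes
-- (x_α, …, x_k), the first α - c entries of the rank cardinality vector.

count-map : ∀ {A B : Set} {P : B → Set} {Q : A → Set} (P? : Decidable P) (Q? : Decidable Q)
  (f : A → B) → (∀ x → P (f x) ⇔ Q x) → ∀ xs →
  length (filter P? (map f xs)) ≡ length (filter Q? xs)
count-map P? Q? f P⇔Q [] = refl
count-map P? Q? f P⇔Q (x ∷ xs) with P? (f x) | Q? x
... | yes p | yes q = cong suc (count-map P? Q? f P⇔Q xs)
... | yes p | no ¬q = contradiction (Equivalence.to (P⇔Q x) p) ¬q
... | no ¬p | yes q = contradiction (Equivalence.from (P⇔Q x) q) ¬p
... | no ¬p | no ¬q = count-map P? Q? f P⇔Q xs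

count-filter-⊆ : ∀ {A : Set} {Q K : A → Set} (Q? : Decidable Q) (K? : Decidable K) →
  (∀ x → Q x → K x) → ∀ xs → length (filter Q? (filter K? xs)) ≡ length (filter Q? xs)
count-filter-⊆ Q? K? Q⊆K [] = refl
count-filter-⊆ Q? K? Q⊆K (x ∷ xs) with K? x
... | yes k with Q? x
...   | yes q = cong suc (count-filter-⊆ Q? K? Q⊆K xs)
...   | no ¬q = count-filter-⊆ Q? K? Q⊆K xs
count-filter-⊆ Q? K? Q⊆K (x ∷ xs) | no ¬k with Q? x
...   | yes q = contradiction (Q⊆K x q) ¬k
...   | no ¬q = count-filter-⊆ Q? K? Q⊆K xs

lookup-injective : ∀ {A : Set} {xs : List A} → Unique xs →
  ∀ i j → lookup xs i ≡ lookup xs j → i ≡ j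
lookup-injective (x∉ ∷ _) Fin.zero Fin.zero _ = refl
lookup-injective (x∉ ∷ _) Fin.zero (Fin.suc j) eq = contradiction eq (All.lookup x∉ (∈-lookup j))
lookup-injective (x∉ ∷ _) (Fin.suc i) Fin.zero eq = contradiction (sym eq) (All.lookup x∉ (∈-lookup i))
lookup-injective (_ ∷ u) (Fin.suc i) (Fin.suc j) eq = cong Fin.suc (lookup-injective u i j eq)

take-downFrom : ∀ {A : Set} (f g : ℕ → A) (c : ℕ) → (∀ i → g i ≡ f (i + c)) →
  ∀ n → map g (downFrom n) ≡ take n (map f (downFrom (n + c)))
take-downFrom f g c g≡f zero = refl
take-downFrom f g c g≡f (suc n) = cong₂ _∷_ (g≡f n) (take-downFrom f g c g≡f n)

length-rankVector : ∀ {n} (ρ : Fin n → ℕ) α → length (rankVector ρ α) ≡ α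
length-rankVector ρ α = trans (length-map _ (downFrom α)) (length-downFrom α)

module Enumeration {N : ℕ} {P : Fin N → Set} (P? : Decidable P) where

  members : List (Fin N)
  members = filter P? (allFin N)

  size : ℕ
  size = length members

  embed : Fin size → Fin N
  embed = lookup members

  embed-sound : ∀ i → P (embed i)
  embed-sound i = proj₂ (∈-filter⁻ P? {xs = allFin N} (∈-lookup i))

  embed-onto : ∀ v → P v → ∃ λ i → embed i ≡ v
  embed-onto v pv = Any.index v∈ , sym (lookup-index v∈)
    where v∈ = ∈-filter⁺ P? (∈-allFin v) pv

  embed-injective : ∀ i j → embed i ≡ embed j → i ≡ j
  embed-injective = lookup-injective (Unique.filter⁺ P? (Unique.allFin⁺ N))

  count-embed : ∀ {Q : Fin N → Set} {R : Fin size → Set} (Q? : Decidable Q) (R? : Decidable R) →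
    (∀ v → Q v → P v) → (∀ i → Q (embed i) ⇔ R i) →
    length (filter R? (allFin size)) ≡ length (filter Q? (allFin N))
  count-embed Q? R? Q⊆P Q⇔R = begin
    length (filter R? (allFin size))             ≡⟨ count-map Q? R? embed Q⇔R (allFin size) ⟨
    length (filter Q? (map embed (allFin size))) ≡⟨ cong (length ∘ filter Q?) map-embed ⟩
    length (filter Q? members)                   ≡⟨ count-filter-⊆ Q? P? Q⊆P (allFin N) ⟩
    length (filter Q? (allFin N))                ∎
    where
      open ≡-Reasoning
      map-embed : map embed (allFin size) ≡ members
      map-embed = trans (map-tabulate (λ i → i) embed) (tabulate-lookup members)

induced : ∀ {N n} → Graph N → (Fin n → Fin N) → Graph n
induced G e = record
  { adj     = λ i j → adj G (e i) (e j)
  ; adj-sym = λ i j → adj-sym G (e i) (e j)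
  ; adj-ref = λ i → adj-ref G (e i) }

Dominates : ∀ {n} → Graph n → VSet n → Fin n → Set
Dominates G S v = ∀ u → S u → Adj G v u

-- Then e is an isomorphism from H[S'] onto G[S], so
-- cliques, strict corners and dominating vertices correspond.
module InducedStage {N n} (G : Graph N) (e : Fin n → Fin N)
  (e-injective : ∀ i j → e i ≡ e j → i ≡ j)
  (S : VSet N) (S' : VSet n) (S'⇔S : ∀ i → S' i ⇔ S (e i))
  (S-onto : ∀ v → S v → ∃ λ i → e i ≡ v) where

  H : Graph n
  H = induced G e

  to : ∀ {i} → S' i → S (e i)
  to {i} = Equivalence.to (S'⇔S i)

  from : ∀ {i} → S (e i) → S' i
  from {i} = Equivalence.from (S'⇔S i)

  reflect : (R : Fin N → Set) → (∀ i → S' i → R (e i)) → ∀ v → S v → R v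
  reflect R R∘e v sv with S-onto v sv
  ... | i , refl = R∘e i (from sv)

  clique-reflect : IsClique H S' → IsClique G S
  clique-reflect clique u v su sv =
    reflect (λ u → Adj G u v) (λ i si → reflect (Adj G (e i)) (λ j sj → clique i j si sj) v sv) u su

  clique-preserve : IsClique G S → IsClique H S'
  clique-preserve clique i j si sj = clique (e i) (e j) (to si) (to sj)

  dominates-reflect : ∀ i → Dominates H S' i → Dominates G S (e i)
  dominates-reflect i dom = reflect (Adj G (e i)) dom

  dominates-preserve : ∀ i → Dominates G S (e i) → Dominates H S' i
  dominates-preserve i dom j sj = dom (e j) (to sj)

  corner-preserve : ∀ i → StrictCorner H S' i → StrictCorner G S (e i)
  corner-preserve i (si , w , sw , w≢i , N[i]⊆N[w] , u , su , u~w , u≁i) =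
    to si , e w , to sw , w≢i ∘ e-injective w i ,
    reflect (λ x → Adj G x (e i) → Adj G x (e w)) N[i]⊆N[w] ,
    e u , to su , u~w , u≁i

  corner-reflect : ∀ i → StrictCorner G S (e i) → StrictCorner H S' i
  corner-reflect i (si , w , sw , w≢ei , N[ei]⊆N[w] , u , su , u~w , u≁ei)
    with S-onto w sw | S-onto u su
  ... | w' , refl | u' , refl =
    from si , w' , from sw , w≢ei ∘ cong e ,
    (λ x sx → N[ei]⊆N[w] (e x) (to sx)) ,
    u' , from su , u~w , u≁ei

  corner-equiv : ∀ i → StrictCorner G S (e i) ⇔ StrictCorner H S' i
  corner-equiv i = mk⇔ (corner-reflect i) (corner-preserve i)

module Truncation {N} (G : Graph N) (α : ℕ) (ρ : Fin N → ℕ) (CR : CornerRanking G α ρ)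
                  (c : ℕ) (c<α : c < α) where
  open CornerRanking CR
  open Enumeration (λ v → c <? ρ v)

  G' : Graph size
  G' = induced G embed

  α' : ℕ
  α' = α ∸ c

  ρ' : Fin size → ℕ
  ρ' i = ρ (embed i) ∸ c

  -- Every vertex of the truncation has rank above c, so lowering by c is exact.
  rank-shift : ∀ i → ρ (embed i) ≡ ρ' i + c
  rank-shift i = sym (m∸n+n≡m (<⇒≤ (embed-sound i)))

  α-shift : α ≡ α' + c
  α-shift = sym (m∸n+n≡m (<⇒≤ c<α))

  rank-equiv : ∀ j i → (ρ' i ≡ j) ⇔ (ρ (embed i) ≡ j + c)
  rank-equiv j i = mk⇔ (λ eq → trans (rank-shift i) (cong (_+ c) eq))
                       (λ eq → +-cancelʳ-≡ c _ _ (trans (sym (rank-shift i)) eq))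

  stage-equiv : ∀ j i → Stage ρ' j i ⇔ Stage ρ (j + c) (embed i)
  stage-equiv j i = mk⇔ (λ le → subst (j + c ≤_) (sym (rank-shift i)) (+-monoˡ-≤ c le))
                        (λ le → +-cancelʳ-≤ c j (ρ' i) (subst (j + c ≤_) (rank-shift i) le))

  -- For j ≥ 1 the (j + c)-th stage of G lies inside the truncation.
  module Level (j : ℕ) (1≤j : 1 ≤ j) = InducedStage G embed embed-injective
    (Stage ρ (j + c)) (Stage ρ' j) (stage-equiv j)
    (λ v le → embed-onto v (≤-trans (+-monoˡ-≤ c 1≤j) le))

  top-vertex : ∀ v → ρ v ≡ α → ∃ λ i → embed i ≡ v × ρ' i ≡ α'
  top-vertex v ρv≡α with embed-onto v (subst (c <_) (sym ρv≡α) c<α)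
  ... | i , refl = i , refl , cong (_∸ c) ρv≡α

  -- Corner rank α' is attained; this vertex also shows the truncation is nonempty.
  top : ∃ λ i → ρ' i ≡ α'
  top with rank-top
  ... | v , ρv≡α with top-vertex v ρv≡α
  ...   | i , _ , ρ'i≡α' = i , ρ'i≡α'

  level-below : ∀ j → j < α' → j + c < α
  level-below j j<α' = subst (j + c <_) (sym α-shift) (+-monoˡ-< c j<α')

  -- The truncation is ranked by ρ - c with corner rank α - c: each axiom at
  -- level j is the axiom of G at level j + c, transported along embed.
  ranking : CornerRanking G' α' ρ'
  ranking = record
    { rank-pos    = λ i → Equivalence.from (stage-equiv 1 i) (embed-sound i)
    ; rank-le     = λ i → ∸-monoˡ-≤ c (rank-le (embed i))
    ; rank-top    = top
    ; stage-noncl = λ j 1≤j j<α' → stage-noncl (j + c) (≤-trans 1≤j (m≤m+n j c)) (level-below j j<α')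
                                     ∘ Level.clique-reflect j 1≤j
    ; stage-corn  = λ j 1≤j j<α' i →
        ⇔.trans (rank-equiv j i)
          (⇔.trans (stage-corn (j + c) (≤-trans 1≤j (m≤m+n j c)) (level-below j j<α') (embed i))
                   (Level.corner-equiv j 1≤j i))
    ; last-clique = Level.clique-preserve α' (m<n⇒0<n∸m c<α)
                      (subst (λ a → IsClique G (Stage ρ a)) α-shift last-clique)
    }

  type1-equiv : 2 ≤ α' → Type1 G α ρ ⇔ Type1 G' α' ρ'
  type1-equiv 2≤α' = mk⇔ type1-to type1-from
    where
      open Level (α' ∸ 1) (m+n≤o⇒m≤o∸n 1 2≤α')
      below-top : α ∸ 1 ≡ (α' ∸ 1) + c
      below-top = trans (cong (_∸ 1) α-shift) (+-∸-comm c (m<n⇒0<n∸m c<α))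
      recast : ∀ v → Dominates G (Stage ρ (α ∸ 1)) v ⇔ Dominates G (Stage ρ ((α' ∸ 1) + c)) v
      recast v = subst (λ a → Dominates G (Stage ρ (α ∸ 1)) v ⇔ Dominates G (Stage ρ a) v)
                   below-top ⇔.refl
      type1-to : Type1 G α ρ → Type1 G' α' ρ'
      type1-to (v , ρv≡α , dom) with top-vertex v ρv≡α
      ... | i , refl , ρ'i≡α' = i , ρ'i≡α' , dominates-preserve i (Equivalence.to (recast v) dom)
      type1-from : Type1 G' α' ρ' → Type1 G α ρ
      type1-from (i , ρ'i≡α' , dom) =
        embed i , trans (Equivalence.to (rank-equiv α' i) ρ'i≡α') (sym α-shift) ,
        Equivalence.from (recast (embed i)) (dominates-reflect i dom)

  type-preserved : ∀ r → HasType G α ρ r → HasType G' α' ρ' r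
  type-preserved r type 2≤α' =
    (λ r≡1 → Equivalence.to (type1-equiv 2≤α') (proj₁ (type 2≤α) r≡1)) ,
    (λ r≡0 → proj₂ (type 2≤α) r≡0 ∘ Equivalence.from (type1-equiv 2≤α'))
    where 2≤α = ≤-trans 2≤α' (m∸n≤m α c)

  count-shift : ∀ j → 1 ≤ j → rankCount ρ' j ≡ rankCount ρ (j + c)
  count-shift j 1≤j = count-embed (λ v → ρ v ≟ j + c) (λ i → ρ' i ≟ j)
    (λ v eq → ≤-trans (+-monoˡ-≤ c 1≤j) (≤-reflexive (sym eq)))
    (λ i → ⇔.sym (rank-equiv j i))

  rank-vector : rankVector ρ' α' ≡ take α' (rankVector ρ α)
  rank-vector = trans
    (take-downFrom (λ i → rankCount ρ (suc i)) (λ i → rankCount ρ' (suc i)) c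
                   (λ i → count-shift (suc i) (s≤s z≤n)) α')
    (cong (λ a → take α' (rankVector ρ a)) (sym α-shift))

  prefix-length : length (rankVector ρ α) ∸ suc c + 1 ≡ α'
  prefix-length = begin
    length (rankVector ρ α) ∸ suc c + 1 ≡⟨ cong (λ a → a ∸ suc c + 1) (length-rankVector ρ α) ⟩
    α ∸ suc c + 1                       ≡⟨ +-comm (α ∸ suc c) 1 ⟩
    suc (α ∸ suc c)                     ≡⟨ +-∸-assoc 1 c<α ⟨
    α' ∎
    where open ≡-Reasoning

Realization : ℕ → ℕ → List ℕ → Set
Realization r n xs = Σ (Graph n) λ G → ∃ λ α → Σ (Fin n → ℕ) λ ρ →
  CornerRanking G α ρ × HasType G α ρ r × rankVector ρ α ≡ xs

realizable : ∀ {r n xs} → All (1 ≤_) xs → Fin n → Realization r n xs → Realizable r xs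
realizable {n = suc m} positive _ R = positive , m , R

lemma3p7 : (r : ℕ) → r ≤ 1 → (xs : List ℕ) → Realizable r xs →
    (k : ℕ) → 1 ≤ k → k ≤ length xs → Realizable r (take (length xs ∸ k + 1) xs)
lemma3p7 r _ xs (positive , _ , G , α , ρ , CR , type , refl) (suc c) _ k≤α =
  realizable (take⁺ _ positive) (proj₁ top)
    (G' , α' , ρ' , ranking , type-preserved r type , vector)
  where
    c<α : c < α
    c<α = subst (suc c ≤_) (length-rankVector ρ α) k≤α
    open Truncation G α ρ CR c c<α
    vector : rankVector ρ' α' ≡ take (length (rankVector ρ α) ∸ suc c + 1) (rankVector ρ α)
    vector = trans rank-vector (cong (λ n → take n (rankVector ρ α)) (sym prefix-length))
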